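{- Let $P^0_{k,m}(j)$ be defined for nonnegative integers $k,j,m$ as in the context, and let $(x)_j=x(x-1)\cdots(x-j+1)$ denote the falling factorial (with $(x)_0=1$). Then for every nonnegative integer $n$ and every integer $j\ge 0$, $$(n)_j=\sum_{v=0}^{j}(-1)^v P^0_{j,v}(1)\,n^{j-v},$$ and for every positive integer $N$ and all nonnegative integers $k,j$ with $j-k\ge 0$, $$(N-k)_{j-k}=\sum_{v=0}^{j-k}(-1)^v P^0_{j,v}(k)\,N^{j-k-v}.$$
   Context: Empty-sum convention: $\sum_{q=a}^b x_q=0$ when $b<a$. For nonnegative integers $k,j,m$ define $P^0_{k,0}(j)=1$ and, for $m\ge 1$, $$P^0_{k,m}(j)=\sum_{q=j}^{k-m} q\,P^0_{k,m-1}(q+1).$$ In the paper the first identity is stated with $n=f_N N$, where $f_N=n/N$ is the sampling fraction of a simple random sample of size $n$ from a population of size $N$. -}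

module Defs where

open import Data.Nat as ℕ using (ℕ; zero; suc; _∸_)
open import Data.Integer as ℤ using (ℤ; +_; _-_; _*_; _+_)

sumFromℕ : ℕ → ℕ → (ℕ → ℕ) → ℕ
sumFromℕ a zero    f = 0
sumFromℕ a (suc c) f = f a ℕ.+ sumFromℕ (suc a) c f

-- P^0_{k,m}(j):  P^0_{k,0}(j) = 1,
-- P^0_{k,m}(j) = Σ_{q=j}^{k-m} q * P^0_{k,m-1}(q+1)  (empty sum if k-m < j).
-- The number of integers q with j ≤ q ≤ k - m (integer arithmetic) is (k+1) ∸ (m+j).
P0 : ℕ → ℕ → ℕ → ℕ
P0 k zero    j = 1
P0 k (suc m) j = sumFromℕ j ((suc k) ∸ (suc m ℕ.+ j)) (λ q → q ℕ.* P0 k m (suc q))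

sumℤ : ℕ → (ℕ → ℤ) → ℤ
sumℤ zero    f = + 0
sumℤ (suc c) f = sumℤ c f + f c

powℤ : ℤ → ℕ → ℤ
powℤ x zero    = + 1
powℤ x (suc n) = x * powℤ x n

negOnePow : ℕ → ℤ
negOnePow v = powℤ (ℤ.- (+ 1)) v

falling : ℤ → ℕ → ℤ
falling x zero    = + 1
falling x (suc j) = falling x j * (x - + j)

-- Write (x - k)_c for the falling factorial of x - k, with j = k + c.  Peeling off the
-- first factor gives (x - k)_(c+1) = (x - k)·(x - (k+1))_c, and on the coefficient side
-- splitting off the q = k term of the sum defining P^0_{j,v+1}(k) gives
-- P^0_{j,v+1}(k) = k·P^0_{j,v}(k+1) + P^0_{j,v+1}(k+1).  These two recurrences match
-- term by term, so induction on c proves (x - k)_c = Σ_v (-1)^v P^0_{j,v}(k) x^(c-v) for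
-- every integer x.  The second identity is the case x = N, c = j - k; the first is k = 0,
-- since the q = 0 term vanishes and so P^0_{j,v}(0) = P^0_{j,v}(1).
module Submission where

open import Defs
open import Data.Nat using (ℕ; _≤_; _∸_; NonZero; suc)
open import Data.Integer using (ℤ; +_; _-_; _*_)
open import Data.Product using (_×_)
open import Relation.Binary.PropositionalEquality using (_≡_)

open import Data.Nat as ℕ using (zero; _<_; s≤s; _≤?_)
import Data.Nat.Properties as ℕ
open import Data.Integer using (_+_; -_)
import Data.Integer.Properties as ℤ
open import Data.Integer.Tactic.RingSolver using (solve-∀)
open import Data.Product using (_,_)
open import Relation.Nullary using (yes; no)
open import Relation.Binary.PropositionalEquality using (refl; sym; trans; cong; cong₂; subst₂)
open Relation.Binary.PropositionalEquality.≡-Reasoning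

sumℤ-cong : ∀ n {f g : ℕ → ℤ} → (∀ v → v < n → f v ≡ g v) → sumℤ n f ≡ sumℤ n g
sumℤ-cong zero    f≗g = refl
sumℤ-cong (suc n) f≗g =
  cong₂ _+_ (sumℤ-cong n (λ v v<n → f≗g v (ℕ.m≤n⇒m≤1+n v<n))) (f≗g n ℕ.≤-refl)

sumℤ-head : ∀ n (f : ℕ → ℤ) → sumℤ (suc n) f ≡ f 0 + sumℤ n (λ v → f (suc v))
sumℤ-head zero    f = trans (ℤ.+-identityˡ (f 0)) (sym (ℤ.+-identityʳ (f 0)))
sumℤ-head (suc n) f = begin
  sumℤ (suc n) f + f (suc n)                      ≡⟨ cong (_+ f (suc n)) (sumℤ-head n f) ⟩
  (f 0 + sumℤ n (λ v → f (suc v))) + f (suc n)    ≡⟨ ℤ.+-assoc (f 0) _ _ ⟩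
  f 0 + sumℤ (suc n) (λ v → f (suc v))            ∎

sumℤ-*ˡ : ∀ n a (f : ℕ → ℤ) → a * sumℤ n f ≡ sumℤ n (λ v → a * f v)
sumℤ-*ˡ zero    a f = ℤ.*-zeroʳ a
sumℤ-*ˡ (suc n) a f =
  trans (ℤ.*-distribˡ-+ a (sumℤ n f) (f n)) (cong (_+ a * f n) (sumℤ-*ˡ n a f))

sumℤ-linear : ∀ n a (f g : ℕ → ℤ) →
  sumℤ n (λ v → f v - a * g v) ≡ sumℤ n f - a * sumℤ n g
sumℤ-linear zero    a f g = cong (λ t → + 0 - t) (sym (ℤ.*-zeroʳ a))
sumℤ-linear (suc n) a f g = begin
  sumℤ n (λ v → f v - a * g v) + (f n - a * g n)
    ≡⟨ cong (_+ (f n - a * g n)) (sumℤ-linear n a f g) ⟩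
  (sumℤ n f - a * sumℤ n g) + (f n - a * g n)
    ≡⟨ regroup a (sumℤ n f) (sumℤ n g) (f n) (g n) ⟩
  (sumℤ n f + f n) - a * (sumℤ n g + g n) ∎
  where
  regroup : ∀ a s t p q → (s - a * t) + (p - a * q) ≡ (s + p) - a * (t + q)
  regroup = solve-∀

falling-suc : ∀ y c → falling y (suc c) ≡ y * falling (y - + 1) c
falling-suc y zero = begin
  + 1 * (y - + 0) ≡⟨ ℤ.*-identityˡ _ ⟩
  y + - + 0       ≡⟨ ℤ.+-identityʳ y ⟩
  y               ≡⟨ ℤ.*-identityʳ y ⟨
  y * + 1         ∎
falling-suc y (suc c) = begin
  falling y (suc c) * (y - + suc c)
    ≡⟨ cong₂ (λ F t → F * (y - t)) (falling-suc y c) (ℤ.pos-+ 1 c) ⟩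
  y * falling (y - + 1) c * (y - (+ 1 + + c))
    ≡⟨ reassoc y (falling (y - + 1) c) (+ c) ⟩
  y * (falling (y - + 1) c * (y - + 1 - + c)) ∎
  where
  reassoc : ∀ y F c → y * F * (y - (+ 1 + c)) ≡ y * (F * (y - + 1 - c))
  reassoc = solve-∀

P0-suc-empty : ∀ j m k → j ≤ m ℕ.+ k → P0 j (suc m) k ≡ 0
P0-suc-empty j m k j≤m+k =
  cong (λ n → sumFromℕ k n (λ q → q ℕ.* P0 j m (suc q))) (ℕ.m≤n⇒m∸n≡0 j≤m+k)

P0-suc-step : ∀ j m k → m ℕ.+ k < j →
  P0 j (suc m) k ≡ k ℕ.* P0 j m (suc k) ℕ.+ P0 j (suc m) (suc k)
P0-suc-step (suc j) m k (s≤s m+k≤j) = begin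
  sumFromℕ k (suc j ∸ (m ℕ.+ k)) f
    ≡⟨ cong (λ n → sumFromℕ k n f) (ℕ.+-∸-assoc 1 m+k≤j) ⟩
  k ℕ.* P0 (suc j) m (suc k) ℕ.+ sumFromℕ (suc k) (j ∸ (m ℕ.+ k)) f
    ≡⟨ cong (λ n → k ℕ.* P0 (suc j) m (suc k) ℕ.+ sumFromℕ (suc k) (suc j ∸ n) f) (ℕ.+-suc m k) ⟨
  k ℕ.* P0 (suc j) m (suc k) ℕ.+ sumFromℕ (suc k) (suc j ∸ (m ℕ.+ suc k)) f ∎
  where
  f : ℕ → ℕ
  f q = q ℕ.* P0 (suc j) m (suc q)

P0-at-0 : ∀ j v → P0 j v 0 ≡ P0 j v 1
P0-at-0 j zero = refl
P0-at-0 j (suc m) with suc (m ℕ.+ 0) ≤? j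
... | yes m+0<j = P0-suc-step j m 0 m+0<j
... | no  m+0≮j = trans (P0-suc-empty j m 0 j≤m+0) (sym (P0-suc-empty j m 1 j≤m+1))
  where
  j≤m+0 : j ≤ m ℕ.+ 0
  j≤m+0 = ℕ.≮⇒≥ m+0≮j
  j≤m+1 : j ≤ m ℕ.+ 1
  j≤m+1 = ℕ.≤-trans j≤m+0 (ℕ.+-monoʳ-≤ m ℕ.z≤n)

expansionTerm : ℕ → ℕ → ℤ → ℕ → ℕ → ℤ
expansionTerm j k x c v = negOnePow v * + P0 j v k * powℤ x (c ∸ v)

expansionTerm-*ˡ : ∀ j k x c v → v ≤ c →
  x * expansionTerm j k x c v ≡ expansionTerm j k x (suc c) v
expansionTerm-*ˡ j k x c v v≤c = begin
  x * (negOnePow v * + P0 j v k * powℤ x (c ∸ v))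
    ≡⟨ commute x (negOnePow v * + P0 j v k) (powℤ x (c ∸ v)) ⟩
  negOnePow v * + P0 j v k * powℤ x (suc (c ∸ v))
    ≡⟨ cong (λ n → negOnePow v * + P0 j v k * powℤ x n) (ℕ.+-∸-assoc 1 v≤c) ⟨
  negOnePow v * + P0 j v k * powℤ x (suc c ∸ v) ∎
  where
  commute : ∀ x a p → x * (a * p) ≡ a * (x * p)
  commute = solve-∀

expansionTerm-top : ∀ j k x c → j ≤ c ℕ.+ k → expansionTerm j k x (suc c) (suc c) ≡ + 0
expansionTerm-top j k x c j≤c+k = begin
  negOnePow (suc c) * + P0 j (suc c) k * powℤ x (c ∸ c)
    ≡⟨ cong (λ n → negOnePow (suc c) * + n * powℤ x (c ∸ c)) (P0-suc-empty j c k j≤c+k) ⟩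
  negOnePow (suc c) * + 0 * powℤ x (c ∸ c)
    ≡⟨ annihilate (negOnePow (suc c)) (powℤ x (c ∸ c)) ⟩
  + 0 ∎
  where
  annihilate : ∀ a p → a * + 0 * p ≡ + 0
  annihilate = solve-∀

expansionTerm-step : ∀ j k x c m → m ℕ.+ k < j →
  expansionTerm j k x (suc c) (suc m)
    ≡ expansionTerm j (suc k) x (suc c) (suc m) - + k * expansionTerm j (suc k) x c m
expansionTerm-step j k x c m m+k<j = begin
  negOnePow (suc m) * + P0 j (suc m) k * p
    ≡⟨ cong (λ n → negOnePow (suc m) * + n * p) (P0-suc-step j m k m+k<j) ⟩
  negOnePow (suc m) * + (k ℕ.* P m ℕ.+ P (suc m)) * p
    ≡⟨ cong (λ t → negOnePow (suc m) * t * p)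
            (trans (ℤ.pos-+ (k ℕ.* P m) _) (cong (_+ + P (suc m)) (ℤ.pos-* k (P m)))) ⟩
  negOnePow (suc m) * (+ k * + P m + + P (suc m)) * p
    ≡⟨ expand (negOnePow m) (+ k) (+ P m) (+ P (suc m)) p ⟩
  negOnePow (suc m) * + P (suc m) * p - + k * (negOnePow m * + P m * p) ∎
  where
  P : ℕ → ℕ
  P v = P0 j v (suc k)
  p : ℤ
  p = powℤ x (c ∸ m)
  expand : ∀ s K A B p → (- + 1 * s) * (K * A + B) * p ≡ (- + 1 * s) * B * p - K * (s * A * p)
  expand = solve-∀

falling-shifted-expansion : ∀ x k c j → k ℕ.+ c ≡ j →
  falling (x - + k) c ≡ sumℤ (suc c) (expansionTerm j k x c)
falling-shifted-expansion x k zero    j k+0≡j = refl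
falling-shifted-expansion x k (suc c) j k+c+1≡j = begin
  falling (x - + k) (suc c)
    ≡⟨ falling-suc (x - + k) c ⟩
  (x - + k) * falling (x - + k - + 1) c
    ≡⟨ cong (λ y → (x - + k) * falling y c) shift ⟩
  (x - + k) * falling (x - + suc k) c
    ≡⟨ cong ((x - + k) *_) (falling-shifted-expansion x (suc k) c j k+1+c≡j) ⟩
  (x - + k) * S
    ≡⟨ distrib x (+ k) S ⟩
  x * S - + k * S
    ≡⟨ cong (_- + k * S) x*S≡ΣU ⟩
  sumℤ (suc (suc c)) U - + k * S
    ≡⟨ cong (_- + k * S) (sumℤ-head (suc c) U) ⟩
  (U 0 + sumℤ (suc c) (λ m → U (suc m))) - + k * S
    ≡⟨ ℤ.+-assoc (U 0) _ _ ⟩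
  U 0 + (sumℤ (suc c) (λ m → U (suc m)) - + k * S)
    ≡⟨ cong (λ t → U 0 + t) (sumℤ-linear (suc c) (+ k) (λ m → U (suc m)) V) ⟨
  U 0 + sumℤ (suc c) (λ m → U (suc m) - + k * V m)
    ≡⟨ cong (λ t → U 0 + t) (sumℤ-cong (suc c) T≡U-kV) ⟨
  T 0 + sumℤ (suc c) (λ m → T (suc m))
    ≡⟨ sumℤ-head (suc c) T ⟨
  sumℤ (suc (suc c)) T ∎
  where
  T U V : ℕ → ℤ
  T = expansionTerm j k x (suc c)
  U = expansionTerm j (suc k) x (suc c)
  V = expansionTerm j (suc k) x c
  S : ℤ
  S = sumℤ (suc c) V

  k+1+c≡j : suc k ℕ.+ c ≡ j
  k+1+c≡j = trans (sym (ℕ.+-suc k c)) k+c+1≡j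

  shift : x - + k - + 1 ≡ x - + suc k
  shift = trans (regroup x (+ k)) (cong (λ t → x - t) (sym (ℤ.pos-+ 1 k)))
    where
    regroup : ∀ x k → x - k - + 1 ≡ x - (+ 1 + k)
    regroup = solve-∀

  distrib : ∀ x k S → (x - k) * S ≡ x * S - k * S
  distrib = solve-∀

  x*S≡ΣU : x * S ≡ sumℤ (suc (suc c)) U
  x*S≡ΣU = begin
    x * S                           ≡⟨ sumℤ-*ˡ (suc c) x V ⟩
    sumℤ (suc c) (λ v → x * V v)    ≡⟨ sumℤ-cong (suc c) (λ v v<c+1 →
                                         expansionTerm-*ˡ j (suc k) x c v (ℕ.≤-pred v<c+1)) ⟩
    sumℤ (suc c) U                  ≡⟨ ℤ.+-identityʳ _ ⟨
    sumℤ (suc c) U + + 0            ≡⟨ cong (λ t → sumℤ (suc c) U + t) top≡0 ⟨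
    sumℤ (suc (suc c)) U            ∎
    where
    top≡0 : U (suc c) ≡ + 0
    top≡0 = expansionTerm-top j (suc k) x c (ℕ.≤-reflexive
      (trans (sym k+c+1≡j) (trans (ℕ.+-comm k (suc c)) (sym (ℕ.+-suc c k)))))

  T≡U-kV : ∀ m → m < suc c → T (suc m) ≡ U (suc m) - + k * V m
  T≡U-kV m (s≤s m≤c) = expansionTerm-step j k x c m
    (subst₂ _<_ (ℕ.+-comm k m) k+c+1≡j (ℕ.+-monoʳ-< k (s≤s m≤c)))

lemma2p2 :
    ((n j : ℕ) →
      falling (+ n) j
        ≡ sumℤ (suc j) (λ v → negOnePow v * (+ P0 j v 1) * powℤ (+ n) (j ∸ v)))
    ×
    ((N k j : ℕ) → NonZero N → k ≤ j →
      falling (+ N - + k) (j ∸ k)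
        ≡ sumℤ (suc (j ∸ k)) (λ v → negOnePow v * (+ P0 j v k) * powℤ (+ N) (j ∸ k ∸ v)))
lemma2p2 = unshifted , shifted
  where
  unshifted : ∀ n j → falling (+ n) j
    ≡ sumℤ (suc j) (λ v → negOnePow v * (+ P0 j v 1) * powℤ (+ n) (j ∸ v))
  unshifted n j = begin
    falling (+ n) j                            ≡⟨ cong (λ x → falling x j) (ℤ.+-identityʳ (+ n)) ⟨
    falling (+ n - + 0) j                      ≡⟨ falling-shifted-expansion (+ n) 0 j j refl ⟩
    sumℤ (suc j) (expansionTerm j 0 (+ n) j)   ≡⟨ sumℤ-cong (suc j) (λ v _ →
      cong (λ t → negOnePow v * + t * powℤ (+ n) (j ∸ v)) (P0-at-0 j v)) ⟩
    sumℤ (suc j) (expansionTerm j 1 (+ n) j)   ∎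

  shifted : ∀ N k j → NonZero N → k ≤ j → falling (+ N - + k) (j ∸ k)
    ≡ sumℤ (suc (j ∸ k)) (λ v → negOnePow v * (+ P0 j v k) * powℤ (+ N) (j ∸ k ∸ v))
  shifted N k j _ k≤j = falling-shifted-expansion (+ N) k (j ∸ k) j (ℕ.m+[n∸m]≡n k≤j)
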